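{- Let $m$ be a positive integer and $k,n$ integers. Then $$\left\lfloor\frac{2n+2k}m\right\rfloor-\left\lfloor\frac{n+k}m\right\rfloor+2\left\lfloor \frac km\right\rfloor-2\left\lfloor\frac{2k}m\right\rfloor\ge 2\left\lfloor\frac nm\right\rfloor-\left\lfloor\frac{2n+1}m\right\rfloor+\left\lfloor\frac{n-k+1}m\right\rfloor,$$ unless $m$ is even and $k\equiv n+1\equiv m/2 \pmod m$, in which case the right-hand side of this inequality equals the left-hand side plus one.
   Context: $\lfloor x\rfloor$ denotes the floor function. -}

module Defs where

open import Data.Nat as ℕ using (ℕ; NonZero)
open import Data.Integer using (ℤ; _/ℕ_; _%ℕ_)

-- ⌊ a / m ⌋ for an integer a and a positive natural m (floor division;
-- stdlib's _/ℕ_ rounds toward -∞, i.e. it is the floor).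
⌊_/_⌋ : ℤ → (m : ℕ) → .{{NonZero m}} → ℤ
⌊ a / m ⌋ = a /ℕ m

module Submission where

-- Replacing k and n by their residues b and a modulo m shifts both sides by the same
-- integer ⌊n/m⌋ − ⌊k/m⌋, so only 0 ≤ a, b < m matters. If 2b < m then ⌊2b/m⌋ = 0 and the
-- inequality is monotonicity of the floor. If 2b ≥ m then ⌊2b/m⌋ = 1 and
-- ⌊(2a+2b)/m⌋ > ⌊(a+b)/m⌋ pays for one of the two units; the other comes from
-- ⌊(a−b+1)/m⌋ = −1 when b > a + 1, or from ⌊(2a+1)/m⌋ ≥ 1 when 2a + 1 ≥ m. What is left is
-- 2(a+1) ≤ m ≤ 2b ≤ 2(a+1), i.e. m = 2b = 2(a+1): there every floor is explicit and the
-- right-hand side exceeds the left-hand side by one.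

open import Data.Nat as ℕ using (ℕ; NonZero)
open import Data.Nat.Divisibility using (_∣_; divides)
open import Data.Product using (_×_; _,_; proj₁; proj₂)
open import Data.Sum using (_⊎_; inj₁; inj₂)
open import Data.Empty using (⊥-elim)
open import Function using (_∘_; _⇔_; mk⇔; Equivalence)
open import Relation.Nullary using (¬_; yes; no)
open import Relation.Binary.PropositionalEquality
  using (_≡_; refl; sym; trans; cong; cong₂; subst; subst₂; module ≡-Reasoning)

module _ where
  open import Data.Nat
    using (suc; s≤s; _+_; _*_; _∸_; _/_; _%_; _≤_; _<_; _≤?_; _<?_; s≤s⁻¹; >-nonZero⁻¹; ≢-nonZero⁻¹)
  open import Data.Nat.Properties
  open import Data.Nat.DivMod
  open import Data.Nat.Divisibility using (∣-refl)

  m*n≤o⇒m≤o/n : ∀ {m n o} .{{_ : NonZero n}} → m * n ≤ o → m ≤ o / n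
  m*n≤o⇒m≤o/n {m} {n} m*n≤o = subst (_≤ _) (m*n/n≡m m n) (/-monoˡ-≤ n m*n≤o)

  n≤m<2n⇒m/n≡1 : ∀ {m n} .{{_ : NonZero n}} → n ≤ m → m < 2 * n → m / n ≡ 1
  n≤m<2n⇒m/n≡1 n≤m m<2n = ≤-antisym (s≤s⁻¹ (m<n*o⇒m/o<n m<2n)) (m≥n⇒m/n>0 n≤m)

  n≤2m⇒m/n<[2*m]/n : ∀ {m n} .{{_ : NonZero n}} → n ≤ 2 * m → m / n < (2 * m) / n
  n≤2m⇒m/n<[2*m]/n {m} {n} n≤2m with m <? n
  ... | yes m<n = subst (_< (2 * m) / n) (sym (m<n⇒m/n≡0 m<n)) (m≥n⇒m/n>0 n≤2m)
  ... | no m≮n = begin-strict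
    m / n          <⟨ m<m+n (m / n) (m≤n⇒m≤n+o 0 (m≥n⇒m/n>0 (≮⇒≥ m≮n))) ⟩
    2 * (m / n)    ≤⟨ m*n≤o⇒m≤o/n (≤-trans (≤-reflexive (*-assoc 2 (m / n) n))
                                             (*-monoʳ-≤ 2 (m/n*n≤m m n))) ⟩
    (2 * m) / n    ∎
    where open ≤-Reasoning

  -- The exceptional case k ≡ n + 1 ≡ m/2 (mod m), read on a = n mod m and b = k mod m.
  ExceptionalResidues : (m a b : ℕ) → Set
  ExceptionalResidues m a b = 2 * b ≡ m × b ≡ suc a

  module Residues (m : ℕ) .{{_ : NonZero m}} (a b : ℕ) (a<m : a < m) (b<m : b < m) where

    ⌊2a+2b⌋ ⌊a+b⌋ ⌊2b⌋ ⌊2a+1⌋ ⌊a+1-b⌋ : ℕ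
    ⌊2a+2b⌋ = (2 * a + 2 * b) / m
    ⌊a+b⌋ = (a + b) / m
    ⌊2b⌋ = (2 * b) / m
    ⌊2a+1⌋ = suc (2 * a) / m
    ⌊a+1-b⌋ = (suc a ∸ b) / m

    ⌊a+b⌋+2⌊2b⌋ : ℕ
    ⌊a+b⌋+2⌊2b⌋ = ⌊a+b⌋ + 2 * ⌊2b⌋

    ⌊a+b⌋≤⌊2a+2b⌋ : ⌊a+b⌋ ≤ ⌊2a+2b⌋
    ⌊a+b⌋≤⌊2a+2b⌋ = /-monoˡ-≤ m (+-mono-≤ (m≤n*m a 2) (m≤n*m b 2))

    ⌊a+1-b⌋≤⌊2a+1⌋ : ⌊a+1-b⌋ ≤ ⌊2a+1⌋
    ⌊a+1-b⌋≤⌊2a+1⌋ = /-monoˡ-≤ m (≤-trans (m∸n≤m (suc a) b) (s≤s (m≤n*m a 2)))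

    ⌊2b⌋≤1 : ⌊2b⌋ ≤ 1
    ⌊2b⌋≤1 = s≤s⁻¹ (m<n*o⇒m/o<n (*-monoʳ-< 2 b<m))

    m≤2b⇒⌊2b⌋≡1 : m ≤ 2 * b → ⌊2b⌋ ≡ 1
    m≤2b⇒⌊2b⌋≡1 m≤2b = n≤m<2n⇒m/n≡1 m≤2b (*-monoʳ-< 2 b<m)

    m≤2b⇒⌊a+b⌋<⌊2a+2b⌋ : m ≤ 2 * b → ⌊a+b⌋ < ⌊2a+2b⌋
    m≤2b⇒⌊a+b⌋<⌊2a+2b⌋ m≤2b = subst (⌊a+b⌋ <_) (cong (_/ m) (*-distribˡ-+ 2 a b))
      (n≤2m⇒m/n<[2*m]/n (≤-trans m≤2b (*-monoʳ-≤ 2 (m≤n+m b a))))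

    m≤2b⇒⌊a+1-b⌋≡0 : m ≤ 2 * b → ⌊a+1-b⌋ ≡ 0
    m≤2b⇒⌊a+1-b⌋≡0 m≤2b = m<n⇒m/n≡0 (≤-<-trans (∸-monoʳ-≤ (suc a) 1≤b) a<m)
      where
      1≤b : 1 ≤ b
      1≤b = *-cancelˡ-< 2 0 b (<-≤-trans (>-nonZero⁻¹ m) m≤2b)

    ⌊a+b⌋+2⌊2b⌋≤1+⌊2a+2b⌋+⌊2a+1⌋ : ⌊a+b⌋+2⌊2b⌋ ≤ 1 + (⌊2a+2b⌋ + ⌊2a+1⌋)
    ⌊a+b⌋+2⌊2b⌋≤1+⌊2a+2b⌋+⌊2a+1⌋ with m ≤? 2 * b
    ... | yes m≤2b = begin
      ⌊a+b⌋ + 2 * ⌊2b⌋        ≤⟨ +-monoʳ-≤ ⌊a+b⌋ (*-monoʳ-≤ 2 ⌊2b⌋≤1) ⟩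
      ⌊a+b⌋ + 2               ≡⟨ +-comm ⌊a+b⌋ 2 ⟩
      1 + suc ⌊a+b⌋           ≤⟨ +-monoʳ-≤ 1 (m≤2b⇒⌊a+b⌋<⌊2a+2b⌋ m≤2b) ⟩
      1 + ⌊2a+2b⌋             ≤⟨ +-monoʳ-≤ 1 (m≤m+n ⌊2a+2b⌋ ⌊2a+1⌋) ⟩
      1 + (⌊2a+2b⌋ + ⌊2a+1⌋)  ∎
      where open ≤-Reasoning
    ... | no m≰2b = begin
      ⌊a+b⌋ + 2 * ⌊2b⌋        ≡⟨ cong (λ t → ⌊a+b⌋ + 2 * t) (m<n⇒m/n≡0 (≰⇒> m≰2b)) ⟩
      ⌊a+b⌋ + 0               ≡⟨ +-identityʳ ⌊a+b⌋ ⟩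
      ⌊a+b⌋                   ≤⟨ ⌊a+b⌋≤⌊2a+2b⌋ ⟩
      ⌊2a+2b⌋                 ≤⟨ m≤m+n ⌊2a+2b⌋ ⌊2a+1⌋ ⟩
      ⌊2a+2b⌋ + ⌊2a+1⌋        ≤⟨ n≤1+n _ ⟩
      1 + (⌊2a+2b⌋ + ⌊2a+1⌋)  ∎
      where open ≤-Reasoning

    residue-inequality : b ≤ suc a →
      ExceptionalResidues m a b ⊎ ⌊a+1-b⌋ + ⌊a+b⌋+2⌊2b⌋ ≤ ⌊2a+2b⌋ + ⌊2a+1⌋
    residue-inequality b≤1+a with m ≤? 2 * b
    ... | no m≰2b = inj₂ (begin
      ⌊a+1-b⌋ + (⌊a+b⌋ + 2 * ⌊2b⌋)
        ≡⟨ cong (λ t → ⌊a+1-b⌋ + (⌊a+b⌋ + 2 * t)) (m<n⇒m/n≡0 (≰⇒> m≰2b)) ⟩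
      ⌊a+1-b⌋ + (⌊a+b⌋ + 0)         ≡⟨ cong (⌊a+1-b⌋ +_) (+-identityʳ ⌊a+b⌋) ⟩
      ⌊a+1-b⌋ + ⌊a+b⌋               ≡⟨ +-comm ⌊a+1-b⌋ ⌊a+b⌋ ⟩
      ⌊a+b⌋ + ⌊a+1-b⌋               ≤⟨ +-mono-≤ ⌊a+b⌋≤⌊2a+2b⌋ ⌊a+1-b⌋≤⌊2a+1⌋ ⟩
      ⌊2a+2b⌋ + ⌊2a+1⌋              ∎)
      where open ≤-Reasoning
    ... | yes m≤2b with m ≤? suc (2 * a)
    ...   | yes m≤2a+1 = inj₂ (begin
      ⌊a+1-b⌋ + (⌊a+b⌋ + 2 * ⌊2b⌋)
        ≡⟨ cong₂ (λ g t → g + (⌊a+b⌋ + 2 * t)) (m≤2b⇒⌊a+1-b⌋≡0 m≤2b) (m≤2b⇒⌊2b⌋≡1 m≤2b) ⟩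
      ⌊a+b⌋ + 2                     ≡⟨ +-suc ⌊a+b⌋ 1 ⟩
      suc ⌊a+b⌋ + 1                 ≤⟨ +-mono-≤ (m≤2b⇒⌊a+b⌋<⌊2a+2b⌋ m≤2b) (m≥n⇒m/n>0 m≤2a+1) ⟩
      ⌊2a+2b⌋ + ⌊2a+1⌋              ∎)
      where open ≤-Reasoning
    ...   | no m≰2a+1 = inj₁ (2b≡m , *-cancelˡ-≡ b (suc a) 2 2b≡2[a+1])
      where
      2[a+1]≤m : 2 * suc a ≤ m
      2[a+1]≤m = subst (_≤ m) (sym (*-suc 2 a)) (≰⇒> m≰2a+1)
      2b≤2[a+1] : 2 * b ≤ 2 * suc a
      2b≤2[a+1] = *-monoʳ-≤ 2 b≤1+a
      2b≡m : 2 * b ≡ m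
      2b≡m = ≤-antisym (≤-trans 2b≤2[a+1] 2[a+1]≤m) m≤2b
      2b≡2[a+1] : 2 * b ≡ 2 * suc a
      2b≡2[a+1] = ≤-antisym 2b≤2[a+1] (≤-trans 2[a+1]≤m m≤2b)

    exceptional-values : ExceptionalResidues m a b → ⌊a+1-b⌋ + ⌊a+b⌋+2⌊2b⌋ ≡ 1 + (⌊2a+2b⌋ + ⌊2a+1⌋)
    exceptional-values (2b≡m , refl) = trans
      (cong₂ _+_ ⌊a+1-b⌋≡0 (cong₂ (λ x y → x + 2 * y) ⌊a+b⌋≡0 ⌊2b⌋≡1))
      (sym (cong₂ (λ x y → 1 + (x + y)) ⌊2a+2b⌋≡1 ⌊2a+1⌋≡0))
      where
      2a<m : 2 * a < m
      2a<m = <-≤-trans (*-monoʳ-< 2 (n<1+n a)) (≤-reflexive 2b≡m)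
      2a+1<m : suc (2 * a) < m
      2a+1<m = subst (_≤ m) (*-suc 2 a) (≤-reflexive 2b≡m)
      ⌊a+1-b⌋≡0 : ⌊a+1-b⌋ ≡ 0
      ⌊a+1-b⌋≡0 = trans (cong (_/ m) (n∸n≡0 (suc a))) (0/n≡0 m)
      ⌊a+b⌋≡0 : ⌊a+b⌋ ≡ 0
      ⌊a+b⌋≡0 = m<n⇒m/n≡0 (subst (_< m) 2a+1≡a+[a+1] 2a+1<m)
        where
        2a+1≡a+[a+1] : suc (2 * a) ≡ a + suc a
        2a+1≡a+[a+1] = trans (cong (λ t → suc (a + t)) (+-identityʳ a)) (sym (+-suc a a))
      ⌊2b⌋≡1 : ⌊2b⌋ ≡ 1
      ⌊2b⌋≡1 = trans (cong (_/ m) 2b≡m) (n/n≡1 m)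
      ⌊2a+2b⌋≡1 : ⌊2a+2b⌋ ≡ 1
      ⌊2a+2b⌋≡1 = begin
        (2 * a + 2 * suc a) / m  ≡⟨ cong (λ t → (2 * a + t) / m) 2b≡m ⟩
        (2 * a + m) / m          ≡⟨ +-distrib-/-∣ʳ (2 * a) ∣-refl ⟩
        2 * a / m + m / m        ≡⟨ cong₂ _+_ (m<n⇒m/n≡0 2a<m) (n/n≡1 m) ⟩
        1                        ∎
        where open ≡-Reasoning
      ⌊2a+1⌋≡0 : ⌊2a+1⌋ ≡ 0
      ⌊2a+1⌋≡0 = m<n⇒m/n≡0 2a+1<m

    exceptional⇔ExceptionalResidues : ((2 ∣ m) × (b ≡ m / 2) × (suc a % m ≡ m / 2)) ⇔ ExceptionalResidues m a b
    exceptional⇔ExceptionalResidues = mk⇔ to from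
      where
      to : (2 ∣ m) × (b ≡ m / 2) × (suc a % m ≡ m / 2) → ExceptionalResidues m a b
      to (2∣m , b≡m/2 , [1+a]%m≡m/2) = 2b≡m , b≡1+a (m≤n⇒m<n∨m≡n a<m)
        where
        2b≡m : 2 * b ≡ m
        2b≡m = trans (cong (2 *_) b≡m/2) (m*[n/m]≡n 2∣m)
        b≡[1+a]%m : b ≡ suc a % m
        b≡[1+a]%m = trans b≡m/2 (sym [1+a]%m≡m/2)
        b≡1+a : suc a < m ⊎ suc a ≡ m → b ≡ suc a
        b≡1+a (inj₁ 1+a<m) = trans b≡[1+a]%m (m<n⇒m%n≡m 1+a<m)
        b≡1+a (inj₂ 1+a≡m) = ⊥-elim (≢-nonZero⁻¹ m (trans (sym 2b≡m) (cong (2 *_) b≡0)))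
          where
          b≡0 : b ≡ 0
          b≡0 = trans b≡[1+a]%m (trans (cong (_% m) 1+a≡m) (n%n≡0 m))
      from : ExceptionalResidues m a b → (2 ∣ m) × (b ≡ m / 2) × (suc a % m ≡ m / 2)
      from (2b≡m , b≡1+a) = divides b (trans (sym 2b≡m) (*-comm 2 b)) , sym m/2≡b , [1+a]%m≡m/2
        where
        m/2≡b : m / 2 ≡ b
        m/2≡b = trans (cong (_/ 2) (trans (sym 2b≡m) (*-comm 2 b))) (m*n/n≡m b 2)
        [1+a]%m≡m/2 : suc a % m ≡ m / 2
        [1+a]%m≡m/2 = trans (m<n⇒m%n≡m (subst (_< m) b≡1+a b<m)) (trans (sym b≡1+a) (sym m/2≡b))

open import Defs
open import Data.Integer using (ℤ; +_; _+_; _-_; _*_; _≥_; _%ℕ_; -_; _≤_; _<_; -<+; +≤+; suc; -1ℤ; _⊖_)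
open import Data.Integer.Properties
open import Algebra.Properties.AbelianGroup +-0-abelianGroup using (∙-cancelʳ)
open import Algebra.Properties.CommutativeSemigroup +-commutativeSemigroup using (xy∙z≈xz∙y)
open import Data.Integer.DivMod using (a≡a%ℕn+[a/ℕn]*n; n%ℕd<d; [n/ℕd]*d≤n; n<s[n/ℕd]*d)
open import Data.Integer.Tactic.RingSolver using (solve-∀)
open import Data.Nat.DivMod using (m<n⇒m/n≡0)
import Data.Nat.Properties as ℕ
open ≡-Reasoning

i<suc[j]⇒i≤j : ∀ {i j} → i < suc j → i ≤ j
i<suc[j]⇒i≤j {j = j} i<suc[j] = subst (_ ≤_) (pred-suc j) (i<j⇒i≤pred[j] i<suc[j])

i+j≤k+l⇒i-l≤k-j : ∀ {i j k l} → i + j ≤ k + l → i - l ≤ k - j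
i+j≤k+l⇒i-l≤k-j {i} {j} {k} {l} i+j≤k+l =
  subst₂ _≤_ (cancelˡ i j l) (cancelʳ k j l) (+-monoˡ-≤ (- (j + l)) i+j≤k+l)
  where
  cancelˡ : ∀ x y z → x + y - (y + z) ≡ x - z
  cancelˡ = solve-∀
  cancelʳ : ∀ x y z → x + z - (y + z) ≡ x - y
  cancelʳ = solve-∀

i+j≡1+k+l⇒i-l≡k-j+1 : ∀ {i j k l} → i + j ≡ + 1 + (k + l) → i - l ≡ k - j + + 1
i+j≡1+k+l⇒i-l≡k-j+1 {i} {j} {k} {l} i+j≡1+k+l = begin
  i - l                  ≡⟨ isolate i j l ⟩
  i + j - (j + l)        ≡⟨ cong (_- (j + l)) i+j≡1+k+l ⟩
  + 1 + (k + l) - (j + l) ≡⟨ rearrange k j l ⟩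
  k - j + + 1            ∎
  where
  isolate : ∀ x y z → x - z ≡ x + y - (y + z)
  isolate = solve-∀
  rearrange : ∀ x y z → + 1 + (x + z) - (y + z) ≡ x - y + + 1
  rearrange = solve-∀

module _ (m : ℕ) .{{_ : NonZero m}} where

  ⌊⌋-unique : ∀ {x t} → t * + m ≤ x → x < suc t * + m → ⌊ x / m ⌋ ≡ t
  ⌊⌋-unique {x} t*m≤x x<[t+1]*m = ≤-antisym
    (i<suc[j]⇒i≤j (*-cancelʳ-<-nonNeg (+ m) (≤-<-trans ([n/ℕd]*d≤n x m) x<[t+1]*m)))
    (i<suc[j]⇒i≤j (*-cancelʳ-<-nonNeg (+ m) (≤-<-trans t*m≤x (n<s[n/ℕd]*d x m))))

  ⌊⌋-shift : ∀ x t → ⌊ x + t * + m / m ⌋ ≡ ⌊ x / m ⌋ + t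
  ⌊⌋-shift x t = ⌊⌋-unique
    (subst (_≤ x + t * + m) (sym (*-distribʳ-+ (+ m) q t)) (+-monoˡ-≤ (t * + m) ([n/ℕd]*d≤n x m)))
    (subst (x + t * + m <_) (distrib q t (+ m)) (+-monoˡ-< (t * + m) (n<s[n/ℕd]*d x m)))
    where
    q = ⌊ x / m ⌋
    distrib : ∀ q t M → (+ 1 + q) * M + t * M ≡ (+ 1 + (q + t)) * M
    distrib = solve-∀

  ⌊⌋-shift-≡ : ∀ {y} x t → y ≡ x + t * + m → ⌊ y / m ⌋ ≡ ⌊ x / m ⌋ + t
  ⌊⌋-shift-≡ x t refl = ⌊⌋-shift x t

  %ℕ-shift : ∀ x t → (x + t * + m) %ℕ m ≡ x %ℕ m
  %ℕ-shift x t = +-injective (∙-cancelʳ ((q + t) * M) _ _ (begin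
    + ((x + t * M) %ℕ m) + (q + t) * M
      ≡⟨ cong (λ s → + ((x + t * M) %ℕ m) + s * M) (⌊⌋-shift x t) ⟨
    + ((x + t * M) %ℕ m) + ⌊ x + t * M / m ⌋ * M      ≡⟨ a≡a%ℕn+[a/ℕn]*n (x + t * M) m ⟨
    x + t * M                                         ≡⟨ cong (_+ t * M) (a≡a%ℕn+[a/ℕn]*n x m) ⟩
    + (x %ℕ m) + q * M + t * M                        ≡⟨ regroup (+ (x %ℕ m)) q t M ⟩
    + (x %ℕ m) + (q + t) * M                          ∎))
    where
    M = + m
    q = ⌊ x / m ⌋
    regroup : ∀ r q t M → r + q * M + t * M ≡ r + (q + t) * M
    regroup = solve-∀

  Exceptional : ℤ → ℤ → Set
  Exceptional k n = (2 ∣ m) × (k %ℕ m ≡ m ℕ./ 2) × ((n + + 1) %ℕ m ≡ m ℕ./ 2)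

  lhs rhs : ℤ → ℤ → ℤ
  lhs k n = ⌊ (+ 2) * n + (+ 2) * k / m ⌋ - ⌊ n + k / m ⌋ + (+ 2) * ⌊ k / m ⌋ - (+ 2) * ⌊ (+ 2) * k / m ⌋
  rhs k n = (+ 2) * ⌊ n / m ⌋ - ⌊ (+ 2) * n + + 1 / m ⌋ + ⌊ n - k + + 1 / m ⌋

  lhs-shift : ∀ k n p q → lhs (k + p * + m) (n + q * + m) ≡ lhs k n + (q - p)
  lhs-shift k n p q = begin
    lhs (k + p * M) (n + q * M)
      ≡⟨ cong₂ _-_
           (cong₂ _+_
             (cong₂ _-_ (⌊⌋-shift-≡ (+ 2 * n + + 2 * k) (+ 2 * q + + 2 * p) (regroup-2n+2k n k q p M))
                        (⌊⌋-shift-≡ (n + k) (q + p) (regroup-n+k n k q p M)))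
             (cong (+ 2 *_) (⌊⌋-shift k p)))
           (cong (+ 2 *_) (⌊⌋-shift-≡ (+ 2 * k) (+ 2 * p) (regroup-2k k p M))) ⟩
    (⌊ + 2 * n + + 2 * k / m ⌋ + (+ 2 * q + + 2 * p)) - (⌊ n + k / m ⌋ + (q + p))
      + + 2 * (⌊ k / m ⌋ + p) - + 2 * (⌊ + 2 * k / m ⌋ + + 2 * p)
      ≡⟨ collect ⌊ + 2 * n + + 2 * k / m ⌋ ⌊ n + k / m ⌋ ⌊ k / m ⌋ ⌊ + 2 * k / m ⌋ p q ⟩
    lhs k n + (q - p) ∎
    where
    M = + m
    regroup-2n+2k : ∀ n k q p M → + 2 * (n + q * M) + + 2 * (k + p * M) ≡ + 2 * n + + 2 * k + (+ 2 * q + + 2 * p) * M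
    regroup-2n+2k = solve-∀
    regroup-n+k : ∀ n k q p M → n + q * M + (k + p * M) ≡ n + k + (q + p) * M
    regroup-n+k = solve-∀
    regroup-2k : ∀ k p M → + 2 * (k + p * M) ≡ + 2 * k + (+ 2 * p) * M
    regroup-2k = solve-∀
    collect : ∀ w x y z p q → (w + (+ 2 * q + + 2 * p)) - (x + (q + p)) + + 2 * (y + p) - + 2 * (z + + 2 * p)
                              ≡ w - x + + 2 * y - + 2 * z + (q - p)
    collect = solve-∀

  rhs-shift : ∀ k n p q → rhs (k + p * + m) (n + q * + m) ≡ rhs k n + (q - p)
  rhs-shift k n p q = begin
    rhs (k + p * M) (n + q * M)
      ≡⟨ cong₂ _+_
           (cong₂ _-_ (cong (+ 2 *_) (⌊⌋-shift n q))
                      (⌊⌋-shift-≡ (+ 2 * n + + 1) (+ 2 * q) (regroup-2n+1 n q M)))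
           (⌊⌋-shift-≡ (n - k + + 1) (q - p) (regroup-n-k+1 n k q p M)) ⟩
    + 2 * (⌊ n / m ⌋ + q) - (⌊ + 2 * n + + 1 / m ⌋ + + 2 * q) + (⌊ n - k + + 1 / m ⌋ + (q - p))
      ≡⟨ collect ⌊ n / m ⌋ ⌊ + 2 * n + + 1 / m ⌋ ⌊ n - k + + 1 / m ⌋ p q ⟩
    rhs k n + (q - p) ∎
    where
    M = + m
    regroup-2n+1 : ∀ n q M → + 2 * (n + q * M) + + 1 ≡ + 2 * n + + 1 + (+ 2 * q) * M
    regroup-2n+1 = solve-∀
    regroup-n-k+1 : ∀ n k q p M → n + q * M - (k + p * M) + + 1 ≡ n - k + + 1 + (q - p) * M
    regroup-n-k+1 = solve-∀
    collect : ∀ x y z p q → + 2 * (x + q) - (y + + 2 * q) + (z + (q - p)) ≡ + 2 * x - y + z + (q - p)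
    collect = solve-∀

  ⌊-d/m⌋≡-1 : ∀ {d} → 0 ℕ.< d → d ℕ.≤ m → ⌊ - + d / m ⌋ ≡ -1ℤ
  ⌊-d/m⌋≡-1 {d@(ℕ.suc _)} _ d≤m =
    ⌊⌋-unique (subst (_≤ - + d) (sym (-1*i≡-i (+ m))) (neg-mono-≤ (+≤+ d≤m))) -<+

  module _ (a b : ℕ) (a<m : a ℕ.< m) (b<m : b ℕ.< m) where
    open Residues m a b a<m b<m

    -- The one floor whose argument can be negative: it is −1 or the ℕ floor ⌊a+1-b⌋.
    ⌊a-b+1⌋ : ℤ
    ⌊a-b+1⌋ = ⌊ + a - + b + + 1 / m ⌋

    lhs-residues : lhs (+ b) (+ a) ≡ + ⌊2a+2b⌋ - + ⌊a+b⌋+2⌊2b⌋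
    lhs-residues = begin
      lhs (+ b) (+ a)
        ≡⟨ cong₂ (λ x z → x - + ⌊a+b⌋ + + 2 * + (b ℕ./ m) - + 2 * z)
                 (cong ⌊_/ m ⌋ (sym (cong₂ _+_ (pos-* 2 a) (pos-* 2 b))))
                 (cong ⌊_/ m ⌋ (sym (pos-* 2 b))) ⟩
      + ⌊2a+2b⌋ - + ⌊a+b⌋ + + 2 * + (b ℕ./ m) - + 2 * + ⌊2b⌋
        ≡⟨ cong (λ y → + ⌊2a+2b⌋ - + ⌊a+b⌋ + + 2 * + y - + 2 * + ⌊2b⌋) (m<n⇒m/n≡0 b<m) ⟩
      + ⌊2a+2b⌋ - + ⌊a+b⌋ + + 2 * + 0 - + 2 * + ⌊2b⌋
        ≡⟨ simplify (+ ⌊2a+2b⌋) (+ ⌊a+b⌋) (+ ⌊2b⌋) ⟩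
      + ⌊2a+2b⌋ - (+ ⌊a+b⌋ + + 2 * + ⌊2b⌋)
        ≡⟨ cong (λ z → + ⌊2a+2b⌋ - (+ ⌊a+b⌋ + z)) (pos-* 2 ⌊2b⌋) ⟨
      + ⌊2a+2b⌋ - + ⌊a+b⌋+2⌊2b⌋
        ∎
      where
      simplify : ∀ x y z → x - y + + 2 * + 0 - + 2 * z ≡ x - (y + + 2 * z)
      simplify = solve-∀

    rhs-residues : rhs (+ b) (+ a) ≡ ⌊a-b+1⌋ - + ⌊2a+1⌋
    rhs-residues = begin
      rhs (+ b) (+ a)
        ≡⟨ cong₂ (λ x y → + 2 * x - y + ⌊a-b+1⌋)
                 (cong +_ (m<n⇒m/n≡0 a<m))
                 (cong ⌊_/ m ⌋ (trans (cong (_+ + 1) (sym (pos-* 2 a))) (+-comm (+ (2 ℕ.* a)) (+ 1)))) ⟩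
      + 2 * + 0 - + ⌊2a+1⌋ + ⌊a-b+1⌋  ≡⟨ simplify (+ ⌊2a+1⌋) ⌊a-b+1⌋ ⟩
      ⌊a-b+1⌋ - + ⌊2a+1⌋              ∎
      where
      simplify : ∀ x y → + 2 * + 0 - x + y ≡ y - x
      simplify = solve-∀

    a-b+1≡[1+a]⊖b : + a - + b + + 1 ≡ ℕ.suc a ⊖ b
    a-b+1≡[1+a]⊖b = trans (move (+ a) (+ b)) (m-n≡m⊖n (ℕ.suc a) b)
      where
      move : ∀ x y → x - y + + 1 ≡ + 1 + x - y
      move = solve-∀

    b≤1+a⇒⌊a-b+1⌋≡⌊a+1-b⌋ : b ℕ.≤ ℕ.suc a → ⌊a-b+1⌋ ≡ + ⌊a+1-b⌋
    b≤1+a⇒⌊a-b+1⌋≡⌊a+1-b⌋ b≤1+a = cong ⌊_/ m ⌋ (trans a-b+1≡[1+a]⊖b (⊖-≥ b≤1+a))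

    1+a<b⇒⌊a-b+1⌋≡-1 : ℕ.suc a ℕ.< b → ⌊a-b+1⌋ ≡ -1ℤ
    1+a<b⇒⌊a-b+1⌋≡-1 1+a<b = trans (cong ⌊_/ m ⌋ (trans a-b+1≡[1+a]⊖b (⊖-< 1+a<b)))
      (⌊-d/m⌋≡-1 (ℕ.m<n⇒0<n∸m 1+a<b) (ℕ.≤-trans (ℕ.m∸n≤m b (ℕ.suc a)) (ℕ.<⇒≤ b<m)))

    exceptional-sum : ExceptionalResidues m a b →
      ⌊a-b+1⌋ + + ⌊a+b⌋+2⌊2b⌋ ≡ + 1 + (+ ⌊2a+2b⌋ + + ⌊2a+1⌋)
    exceptional-sum e@(_ , b≡1+a) = trans
      (cong (_+ + ⌊a+b⌋+2⌊2b⌋) (b≤1+a⇒⌊a-b+1⌋≡⌊a+1-b⌋ (ℕ.≤-reflexive b≡1+a)))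
      (cong +_ (exceptional-values e))

    non-exceptional-sum : ¬ ExceptionalResidues m a b → ⌊a-b+1⌋ + + ⌊a+b⌋+2⌊2b⌋ ≤ + ⌊2a+2b⌋ + + ⌊2a+1⌋
    non-exceptional-sum ¬e with b ℕ.≤? ℕ.suc a
    ... | yes b≤1+a with residue-inequality b≤1+a
    ...   | inj₁ e = ⊥-elim (¬e e)
    ...   | inj₂ ineq = subst (λ x → x + + ⌊a+b⌋+2⌊2b⌋ ≤ + ⌊2a+2b⌋ + + ⌊2a+1⌋)
      (sym (b≤1+a⇒⌊a-b+1⌋≡⌊a+1-b⌋ b≤1+a)) (+≤+ ineq)
    non-exceptional-sum _ | no b≰1+a = subst (λ x → x + + ⌊a+b⌋+2⌊2b⌋ ≤ + ⌊2a+2b⌋ + + ⌊2a+1⌋)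
      (sym (1+a<b⇒⌊a-b+1⌋≡-1 (ℕ.≰⇒> b≰1+a)))
      (+-monoʳ-≤ -1ℤ (+≤+ ⌊a+b⌋+2⌊2b⌋≤1+⌊2a+2b⌋+⌊2a+1⌋))

    residue-theorem : (ExceptionalResidues m a b → rhs (+ b) (+ a) ≡ lhs (+ b) (+ a) + + 1)
                    × (¬ ExceptionalResidues m a b → lhs (+ b) (+ a) ≥ rhs (+ b) (+ a))
    residue-theorem = exceptional , non-exceptional
      where
      exceptional : ExceptionalResidues m a b → rhs (+ b) (+ a) ≡ lhs (+ b) (+ a) + + 1
      exceptional e = subst₂ (λ x y → x ≡ y + + 1) (sym rhs-residues) (sym lhs-residues)
        (i+j≡1+k+l⇒i-l≡k-j+1 {⌊a-b+1⌋} {+ ⌊a+b⌋+2⌊2b⌋} {+ ⌊2a+2b⌋} {+ ⌊2a+1⌋} (exceptional-sum e))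
      non-exceptional : ¬ ExceptionalResidues m a b → lhs (+ b) (+ a) ≥ rhs (+ b) (+ a)
      non-exceptional ¬e = subst₂ _≤_ (sym rhs-residues) (sym lhs-residues)
        (i+j≤k+l⇒i-l≤k-j {⌊a-b+1⌋} {+ ⌊a+b⌋+2⌊2b⌋} {+ ⌊2a+2b⌋} {+ ⌊2a+1⌋} (non-exceptional-sum ¬e))


  lhs-reduce : ∀ k n → lhs k n ≡ lhs (+ (k %ℕ m)) (+ (n %ℕ m)) + (⌊ n / m ⌋ - ⌊ k / m ⌋)
  lhs-reduce k n = trans (cong₂ lhs (a≡a%ℕn+[a/ℕn]*n k m) (a≡a%ℕn+[a/ℕn]*n n m))
                         (lhs-shift (+ (k %ℕ m)) (+ (n %ℕ m)) ⌊ k / m ⌋ ⌊ n / m ⌋)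

  rhs-reduce : ∀ k n → rhs k n ≡ rhs (+ (k %ℕ m)) (+ (n %ℕ m)) + (⌊ n / m ⌋ - ⌊ k / m ⌋)
  rhs-reduce k n = trans (cong₂ rhs (a≡a%ℕn+[a/ℕn]*n k m) (a≡a%ℕn+[a/ℕn]*n n m))
                         (rhs-shift (+ (k %ℕ m)) (+ (n %ℕ m)) ⌊ k / m ⌋ ⌊ n / m ⌋)

  Exceptional⇔ExceptionalResidues : ∀ k n → Exceptional k n ⇔ ExceptionalResidues m (n %ℕ m) (k %ℕ m)
  Exceptional⇔ExceptionalResidues k n =
    subst (λ r → ((2 ∣ m) × (k %ℕ m ≡ m ℕ./ 2) × (r ≡ m ℕ./ 2)) ⇔ ExceptionalResidues m a (k %ℕ m))
          (sym [n+1]%m≡[a+1]%m)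
          (Residues.exceptional⇔ExceptionalResidues m a (k %ℕ m) (n%ℕd<d n m) (n%ℕd<d k m))
    where
    a = n %ℕ m
    [n+1]%m≡[a+1]%m : (n + + 1) %ℕ m ≡ ℕ.suc a ℕ.% m
    [n+1]%m≡[a+1]%m = begin
      (n + + 1) %ℕ m                 ≡⟨ cong (λ x → (x + + 1) %ℕ m) (a≡a%ℕn+[a/ℕn]*n n m) ⟩
      (+ a + ⌊ n / m ⌋ * + m + + 1) %ℕ m  ≡⟨ cong (_%ℕ m) (move (+ a) ⌊ n / m ⌋ (+ m)) ⟩
      (+ ℕ.suc a + ⌊ n / m ⌋ * + m) %ℕ m  ≡⟨ %ℕ-shift (+ ℕ.suc a) ⌊ n / m ⌋ ⟩
      ℕ.suc a ℕ.% m                  ∎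
      where
      move : ∀ r q M → r + q * M + + 1 ≡ + 1 + r + q * M
      move = solve-∀

theorem2p3 : (m : ℕ) → .{{_ : NonZero m}} → (k n : ℤ) →
    let LHS = ⌊ (+ 2) * n + (+ 2) * k / m ⌋ - ⌊ n + k / m ⌋ + (+ 2) * ⌊ k / m ⌋ - (+ 2) * ⌊ (+ 2) * k / m ⌋
        RHS = (+ 2) * ⌊ n / m ⌋ - ⌊ (+ 2) * n + + 1 / m ⌋ + ⌊ n - k + + 1 / m ⌋
        exceptional = (2 ∣ m) × (k %ℕ m ≡ m ℕ./ 2) × ((n + + 1) %ℕ m ≡ m ℕ./ 2)
    in (exceptional → RHS ≡ LHS + + 1) × (¬ exceptional → LHS ≥ RHS)
theorem2p3 m k n = exceptional , non-exceptional
  where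
  s = ⌊ n / m ⌋ - ⌊ k / m ⌋
  residue-case = residue-theorem m (n %ℕ m) (k %ℕ m) (n%ℕd<d n m) (n%ℕd<d k m)
  open Equivalence (Exceptional⇔ExceptionalResidues m k n)

  exceptional : Exceptional m k n → rhs m k n ≡ lhs m k n + + 1
  exceptional e = begin
    rhs m k n                                       ≡⟨ rhs-reduce m k n ⟩
    rhs m (+ (k %ℕ m)) (+ (n %ℕ m)) + s             ≡⟨ cong (_+ s) (proj₁ residue-case (to e)) ⟩
    lhs m (+ (k %ℕ m)) (+ (n %ℕ m)) + + 1 + s       ≡⟨ xy∙z≈xz∙y (lhs m (+ (k %ℕ m)) (+ (n %ℕ m))) (+ 1) s ⟩
    lhs m (+ (k %ℕ m)) (+ (n %ℕ m)) + s + + 1       ≡⟨ cong (_+ + 1) (lhs-reduce m k n) ⟨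
    lhs m k n + + 1                                 ∎

  non-exceptional : ¬ Exceptional m k n → lhs m k n ≥ rhs m k n
  non-exceptional ¬e = subst₂ _≤_ (sym (rhs-reduce m k n)) (sym (lhs-reduce m k n))
    (+-monoˡ-≤ s (proj₂ residue-case (¬e ∘ from)))
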